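{- The complete tripartite graph $K_{2,2,2}$ is not a double approval interval graph.
   Context: An approval interval is a triple $I(a)=(a_l,a_a,a_r)$ of reals with $a_l<a_a<a_r$. A double approval interval representation of a graph $G$ assigns to each vertex $a$ an approval interval $I(a)$ such that distinct vertices $a,b$ are adjacent if and only if $[a_l,a_r]$ and $[b_l,b_r]$ intersect and their intersection contains both approval marks $a_a$ and $b_a$. A graph is a double approval interval graph if it has such a representation.
   Formalization: The approval intervals are triples of rationals rather than of reals, with endpoints and approval marks all taken in ℚ. -}

module Defs where

open import Data.Nat using (ℕ)
open import Data.Nat.DivMod using (_%_)
open import Data.Fin using (Fin; toℕ)
open import Data.Rational using (ℚ; _≤_; _<_; _⊔_; _⊓_)
open import Data.Product using (_×_; Σ)
open import Relation.Binary.PropositionalEquality using (_≡_)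
open import Relation.Nullary using (¬_)
open import Function.Bundles using (_⇔_)

record ApprovalInterval : Set where
  constructor approval
  field
    left     : ℚ
    mark     : ℚ
    right    : ℚ
    left<mark  : left < mark
    mark<right : mark < right
open ApprovalInterval public

DAAdjacent : ApprovalInterval → ApprovalInterval → Set
DAAdjacent a b =
  (left a ⊔ left b ≤ right a ⊓ right b) ×
  ((left a ⊔ left b ≤ mark a) × (mark a ≤ right a ⊓ right b)) ×
  ((left a ⊔ left b ≤ mark b) × (mark b ≤ right a ⊓ right b))

IsDARepresentation : {n : ℕ} → (Fin n → Fin n → Set) → (Fin n → ApprovalInterval) → Set
IsDARepresentation {n} E I = (u v : Fin n) → ¬ (u ≡ v) → (E u v ⇔ DAAdjacent (I u) (I v))

IsDoubleApprovalIntervalGraph : {n : ℕ} → (Fin n → Fin n → Set) → Set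
IsDoubleApprovalIntervalGraph {n} E = Σ (Fin n → ApprovalInterval) (IsDARepresentation E)

-- K_{2,2,2}: vertices 0..5, part of i is i mod 3; adjacent iff different parts.
K222 : Fin 6 → Fin 6 → Set
K222 u v = ¬ (toℕ u % 3 ≡ toℕ v % 3)

{-# OPTIONS --safe #-}
module Submission where

-- Two non-adjacent vertices u, v of the same part with mark u ≤ mark v have
-- mark u < left v or right u < mark v.  Since u and v have the same neighbours,
-- and every neighbour's mark lies in both spans, either u's mark lies below
-- the marks of all other parts or v's mark lies above them.  By pigeonhole two
-- of the three parts contain such extreme vertices of the same kind, but two
-- adjacent vertices cannot both lie below (or above) each other.

open import Defs
open import Relation.Nullary using (¬_; yes; no)
open import Data.Nat using (ℕ; NonZero; _*_; _+_)
open import Data.Nat.Properties using (n<1+n)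
open import Data.Nat.DivMod using (_%_; %-remove-+ˡ; m<n⇒m%n≡m)
open import Data.Nat.Divisibility using (m∣m*n)
open import Data.Fin using (Fin; toℕ; combine)
open import Data.Fin.Patterns using (0F; 1F)
open import Data.Fin.Properties
  using (toℕ-combine; toℕ<n; toℕ-injective; combine-injectiveˡ; pigeonhole; <⇒≢)
open import Data.Rational using (ℚ; _≤_; _<_)
open import Data.Rational.Properties
  using (≤-trans; ≤-total; <⇒≤; ≮⇒≥; _<?_; <-asym; <-≤-trans; ≤-<-trans; ⊔-lub; ⊓-glb;
         p≤p⊔q; p≤q⊔p; p⊓q≤p; p⊓q≤q)
open import Data.Product using (_×_; _,_; proj₁; proj₂; ∃)
open import Data.Sum using (_⊎_; inj₁; inj₂; [_,_])
open import Data.Empty using (⊥; ⊥-elim)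
open import Function using (const; _∘_; case_of_)
open import Function.Bundles using (_⇔_; mk⇔; Equivalence)
open import Relation.Binary.PropositionalEquality
  using (_≡_; _≢_; refl; sym; trans; cong; module ≡-Reasoning)

_∈[_] : ℚ → ApprovalInterval → Set
q ∈[ a ] = left a ≤ q × q ≤ right a

DAAdjacent⇔marks∈spans : ∀ a b → DAAdjacent a b ⇔ (mark a ∈[ b ] × mark b ∈[ a ])
DAAdjacent⇔marks∈spans a b = mk⇔ to from
  where
  to : DAAdjacent a b → mark a ∈[ b ] × mark b ∈[ a ]
  to (_ , (la , ra) , (lb , rb)) =
    (≤-trans (p≤q⊔p (left a) (left b)) la , ≤-trans ra (p⊓q≤q (right a) (right b))) ,
    (≤-trans (p≤p⊔q (left a) (left b)) lb , ≤-trans rb (p⊓q≤p (right a) (right b)))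

  from : mark a ∈[ b ] × mark b ∈[ a ] → DAAdjacent a b
  from ((la , ra) , (lb , rb)) = ≤-trans l≤ma ma≤r , (l≤ma , ma≤r) , (l≤mb , mb≤r)
    where
    l≤ma = ⊔-lub (<⇒≤ (left<mark a)) la
    ma≤r = ⊓-glb (<⇒≤ (mark<right a)) ra
    l≤mb = ⊔-lub lb (<⇒≤ (left<mark b))
    mb≤r = ⊓-glb rb (<⇒≤ (mark<right b))

DAAdjacent⇒mark∈span : ∀ a b → DAAdjacent a b → mark a ∈[ b ]
DAAdjacent⇒mark∈span a b = proj₁ ∘ Equivalence.to (DAAdjacent⇔marks∈spans a b)

¬DAAdjacent⇒separated : ∀ a b → mark a ≤ mark b → ¬ DAAdjacent a b →
                        mark a < left b ⊎ right a < mark b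
¬DAAdjacent⇒separated a b ma≤mb ¬adj with mark a <? left b | right a <? mark b
... | yes ma<lb | _          = inj₁ ma<lb
... | no  _     | yes ra<mb  = inj₂ ra<mb
... | no  ma≮lb | no  ra≮mb  = ⊥-elim (¬adj (Equivalence.from (DAAdjacent⇔marks∈spans a b)
    ( (≮⇒≥ ma≮lb , ≤-trans ma≤mb (<⇒≤ (mark<right b)))
    , (≤-trans (<⇒≤ (left<mark a)) ma≤mb , ≮⇒≥ ra≮mb))))

¬DAAdjacent⇒extreme : ∀ a b → mark a ≤ mark b → ¬ DAAdjacent a b →
                      (∀ c → DAAdjacent c b → mark a < mark c) ⊎
                      (∀ c → DAAdjacent c a → mark c < mark b)
¬DAAdjacent⇒extreme a b ma≤mb ¬adj with ¬DAAdjacent⇒separated a b ma≤mb ¬adj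
... | inj₁ ma<lb = inj₁ λ c c~b → <-≤-trans ma<lb (proj₁ (DAAdjacent⇒mark∈span c b c~b))
... | inj₂ ra<mb = inj₂ λ c c~a → ≤-<-trans (proj₂ (DAAdjacent⇒mark∈span c a c~a)) ra<mb

toℕ-combine-% : ∀ {m n} (k : Fin m) (i : Fin n) .{{_ : NonZero n}} →
                toℕ (combine k i) % n ≡ toℕ i
toℕ-combine-% {n = n} k i = begin
  toℕ (combine k i) % n    ≡⟨ cong (_% n) (toℕ-combine k i) ⟩
  (n * toℕ k + toℕ i) % n  ≡⟨ %-remove-+ˡ (toℕ i) (m∣m*n (toℕ k)) ⟩
  toℕ i % n                ≡⟨ m<n⇒m%n≡m (toℕ<n i) ⟩
  toℕ i                    ∎
  where open ≡-Reasoning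

part : Fin 6 → ℕ
part u = toℕ u % 3

-- vertex k i = 3 k + i is the k-th vertex of part i.
vertex : Fin 2 → Fin 3 → Fin 6
vertex = combine

part-vertex : ∀ k i → part (vertex k i) ≡ toℕ i
part-vertex k i = toℕ-combine-% k i

vertex-injectiveˡ : ∀ {k l} i → vertex k i ≡ vertex l i → k ≡ l
vertex-injectiveˡ i = combine-injectiveˡ _ i _ i

K222-irrefl : ∀ u v → K222 u v → u ≢ v
K222-irrefl u v u~v refl = u~v refl

K222-sym : ∀ u v → K222 u v → K222 v u
K222-sym u v u~v eq = u~v (sym eq)

K222-vertex : ∀ {i j : Fin 3} (k l : Fin 2) → i ≢ j → K222 (vertex k i) (vertex l j)
K222-vertex {i} {j} k l i≢j eq =
  i≢j (toℕ-injective (trans (sym (part-vertex k i)) (trans eq (part-vertex l j))))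

kind : ∀ {a b} {A : Set a} {B : Set b} → A ⊎ B → Fin 2
kind = [ const 0F , const 1F ]

module _ (I : Fin 6 → ApprovalInterval) (R : IsDARepresentation K222 I) where

  m : Fin 6 → ℚ
  m u = mark (I u)

  Lowest Highest : Fin 6 → Set
  Lowest  u = ∀ v → K222 u v → m u < m v
  Highest u = ∀ v → K222 u v → m v < m u

  adjacent : ∀ u v → K222 u v → DAAdjacent (I u) (I v)
  adjacent u v u~v = Equivalence.to (R u v (K222-irrefl u v u~v)) u~v

  nonadjacent : ∀ u v → u ≢ v → part u ≡ part v → ¬ DAAdjacent (I u) (I v)
  nonadjacent u v u≢v same adj = Equivalence.from (R u v u≢v) adj same

  ordered-twins-extreme : ∀ u v → u ≢ v → part u ≡ part v → m u ≤ m v →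
                          Lowest u ⊎ Highest v
  ordered-twins-extreme u v u≢v same mu≤mv
    with ¬DAAdjacent⇒extreme (I u) (I v) mu≤mv (nonadjacent u v u≢v same)
  ... | inj₁ below = inj₁ λ w u~w →
          below (I w) (adjacent w v λ w~v → u~w (trans same (sym w~v)))
  ... | inj₂ above = inj₂ λ w v~w →
          above (I w) (adjacent w u λ w~u → v~w (trans (sym same) (sym w~u)))

  twins-extreme : ∀ u v → u ≢ v → part u ≡ part v →
                  (Lowest u ⊎ Lowest v) ⊎ (Highest u ⊎ Highest v)
  twins-extreme u v u≢v same with ≤-total (m u) (m v)
  ... | inj₁ mu≤mv = [ inj₁ ∘ inj₁ , inj₂ ∘ inj₂ ]
                       (ordered-twins-extreme u v u≢v same mu≤mv)
  ... | inj₂ mv≤mu = [ inj₁ ∘ inj₂ , inj₂ ∘ inj₁ ]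
                       (ordered-twins-extreme v u (u≢v ∘ sym) (sym same) mv≤mu)

  HasLowest HasHighest : Fin 3 → Set
  HasLowest  i = ∃ λ k → Lowest  (vertex k i)
  HasHighest i = ∃ λ k → Highest (vertex k i)

  part-extreme : ∀ i → HasLowest i ⊎ HasHighest i
  part-extreme i with twins-extreme (vertex 0F i) (vertex 1F i)
                        (λ eq → case vertex-injectiveˡ {0F} {1F} i eq of λ ())
                        (trans (part-vertex 0F i) (sym (part-vertex 1F i)))
  ... | inj₁ (inj₁ l) = inj₁ (0F , l)
  ... | inj₁ (inj₂ l) = inj₁ (1F , l)
  ... | inj₂ (inj₁ h) = inj₂ (0F , h)
  ... | inj₂ (inj₂ h) = inj₂ (1F , h)

  ¬K222-Lowest : ∀ u v → Lowest u → Lowest v → ¬ K222 u v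
  ¬K222-Lowest u v low low' u~v = <-asym (low v u~v) (low' u (K222-sym u v u~v))

  ¬K222-Highest : ∀ u v → Highest u → Highest v → ¬ K222 u v
  ¬K222-Highest u v high high' u~v = <-asym (high v u~v) (high' u (K222-sym u v u~v))

  ¬HasLowest² : ∀ {i j} → i ≢ j → HasLowest i → HasLowest j → ⊥
  ¬HasLowest² {i} {j} i≢j (k , low) (l , low') =
    ¬K222-Lowest (vertex k i) (vertex l j) low low' (K222-vertex k l i≢j)

  ¬HasHighest² : ∀ {i j} → i ≢ j → HasHighest i → HasHighest j → ⊥
  ¬HasHighest² {i} {j} i≢j (k , high) (l , high') =
    ¬K222-Highest (vertex k i) (vertex l j) high high' (K222-vertex k l i≢j)

  same-kind⇒⊥ : ∀ {i j} → i ≢ j →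
                (eᵢ : HasLowest i ⊎ HasHighest i) (eⱼ : HasLowest j ⊎ HasHighest j) →
                kind eᵢ ≡ kind eⱼ → ⊥
  same-kind⇒⊥ i≢j (inj₁ l) (inj₁ l') _ = ¬HasLowest² i≢j l l'
  same-kind⇒⊥ i≢j (inj₂ h) (inj₂ h') _ = ¬HasHighest² i≢j h h'

  no-representation : ⊥
  no-representation with pigeonhole (n<1+n 2) (kind ∘ part-extreme)
  ... | i , j , i<j , eq = same-kind⇒⊥ (<⇒≢ i<j) (part-extreme i) (part-extreme j) eq

proposition26 : ¬ IsDoubleApprovalIntervalGraph K222
proposition26 (I , R) = no-representation I R
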